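{- Let $k\ge 0$ be an integer and let $\prec$ be a linear ordering of the vertices of a graph $G$. If $G$ has a decreasing spanning tree $T$ of depth at most $k$, then $\mathrm{wcol}_{\prec,k}(G)=|V(G)|$, and for each $v\in V(G)$ the induced subgraph $G[\{u\in V(G)\colon v\preceq u\}]$ is connected and has diameter at most $2k$.
   Context: A path $v_1\ldots v_m$ is decreasing (w.r.t. $\prec$) if $v_1\succ\cdots\succ v_m$. A decreasing spanning tree is a spanning tree of $G$ rooted at the $\prec$-maximum vertex such that every path in the tree starting at the root is decreasing. $u$ is weakly $k$-reachable from $v$ if $u\preceq v$ and there is a path from $v$ to $u$ of length at most $k$ with all internal vertices greater than $u$; $\mathrm{wcol}_{\prec,k}(G)$ is the maximum over $v$ of the number of vertices weakly $k$-reachable from $v$. -}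

module Defs where

open import Data.Nat using (ℕ; zero; suc; _≤_; _<_)
open import Data.Fin using (Fin)
open import Data.List using (List; []; _∷_; length)
open import Data.List.Relation.Unary.All using (All)
open import Data.List.Relation.Unary.Unique.Propositional using (Unique)
open import Data.List.Membership.Propositional using (_∈_)
open import Data.Product using (Σ; ∃; _×_; _,_)
open import Function.Bundles using (_⇔_)
open import Relation.Binary.PropositionalEquality using (_≡_)
open import Relation.Nullary using (¬_)

record Graph (n : ℕ) : Set₁ where
  field
    E     : Fin n → Fin n → Set
    sym   : ∀ {a b} → E a b → E b a
    irrefl : ∀ {a} → ¬ E a a

record LinOrder (n : ℕ) : Set where
  field
    rank : Fin n → ℕ
    rank-inj : ∀ {a b} → rank a ≡ rank b → a ≡ b

module _ {n : ℕ} (G : Graph n) (O : LinOrder n) where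
  open Graph G
  open LinOrder O

  _≺_ : Fin n → Fin n → Set
  a ≺ b = rank a < rank b

  _⪯_ : Fin n → Fin n → Set
  a ⪯ b = rank a ≤ rank b

  data Walk : Fin n → Fin n → ℕ → Set where
    []  : ∀ {a} → Walk a a zero
    _∷_ : ∀ {a b c ℓ} → E a b → Walk b c ℓ → Walk a c (suc ℓ)

  verts : ∀ {a b ℓ} → Walk a b ℓ → List (Fin n)
  verts {a} []      = a ∷ []
  verts {a} (e ∷ w) = a ∷ verts w

  inner : ∀ {a b ℓ} → Walk a b ℓ → List (Fin n)
  inner []                  = []
  inner (e ∷ [])            = []
  inner (_∷_ {b = b} e (e' ∷ w)) = b ∷ inner (e' ∷ w)

  IsPath : ∀ {a b ℓ} → Walk a b ℓ → Set
  IsPath w = Unique (verts w)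

  WReach : ℕ → Fin n → Fin n → Set
  WReach k v u = u ⪯ v × Σ ℕ λ ℓ → ℓ ≤ k × Σ (Walk v u ℓ) λ w →
                   IsPath w × All (λ x → u ≺ x) (inner w)

  HasSize : (Fin n → Set) → ℕ → Set
  HasSize P m = Σ (List (Fin n)) λ xs →
                  Unique xs × length xs ≡ m × (∀ u → (u ∈ xs) ⇔ P u)

  WcolIs : ℕ → ℕ → Set
  WcolIs k m = (∃ λ v → HasSize (WReach k v) m)
             × (∀ v m' → HasSize (WReach k v) m' → m' ≤ m)

  iter : (Fin n → Fin n) → ℕ → Fin n → Fin n
  iter p zero    x = x
  iter p (suc j) x = p (iter p j x)

  -- A decreasing spanning tree of depth at most k, rooted at the ≺-maximum vertex,
  -- encoded by its parent function: every non-root vertex v is adjacent in G to its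
  -- parent, which is ≻ v (so every root-path in the tree is decreasing), and every
  -- vertex reaches the root in at most k parent steps (tree spans G, depth ≤ k).
  record DecSpanningTree (k : ℕ) : Set where
    field
      root     : Fin n
      root-max : ∀ v → v ⪯ root
      parent   : Fin n → Fin n
      edge     : ∀ v → ¬ v ≡ root → E v (parent v)
      decr     : ∀ v → ¬ v ≡ root → v ≺ parent v
      depth    : ∀ v → Σ ℕ λ j → j ≤ k × iter parent j v ≡ root

  -- G[{u : v ⪯ u}] is connected with diameter ≤ d: any two of its vertices are joined
  -- by a path of length ≤ d lying entirely inside the set.
  UpSetConnDiam : Fin n → ℕ → Set
  UpSetConnDiam v d = ∀ a b → v ⪯ a → v ⪯ b →
    Σ ℕ λ ℓ → ℓ ≤ d × Σ (Walk a b ℓ) λ w → IsPath w × All (λ x → v ⪯ x) (verts w)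

{-# OPTIONS --safe #-}
-- In a decreasing spanning tree the tree path from the root r down to any vertex u is
-- decreasing, so its internal vertices all exceed u; as the depth is at most k, every
-- vertex is weakly k-reachable from r, and wcol is n. For v ⪯ a, b the tree walk from a
-- up to r and back down to b has length at most 2k and each of its vertices exceeds a
-- or b, hence v; shortcutting it to a path bounds the diameter of the up-set of v.
module Submission where

open import Defs
open import Data.Nat using (ℕ; _*_; zero; suc; _+_; _≤_; _<_; z≤n; s≤s)
open import Data.Nat.Properties
  using (<⇒≤; ≤-refl; ≤-trans; ≤-reflexive; <-≤-trans; <-irrefl; m≤n⇒m≤1+n; +-mono-≤; +-identityʳ)
open import Data.Fin using (Fin; _≟_)
open import Data.Fin.Properties using (injective⇒≤)
open import Data.Product using (_×_; Σ; _,_)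
open import Data.List as List using (List; []; _∷_; length; lookup; allFin)
open import Data.List.Relation.Unary.All as All using (All; []; _∷_)
open import Data.List.Relation.Unary.All.Properties using (++⁺; anti-mono; ¬Any⇒All¬)
open import Data.List.Relation.Unary.Any using (here; there)
open import Data.List.Relation.Unary.AllPairs as AllPairs using (AllPairs; []; _∷_)
import Data.List.Relation.Unary.AllPairs.Properties as AllPairs
open import Data.List.Relation.Unary.Unique.Propositional using (Unique)
open import Data.List.Relation.Unary.Unique.Propositional.Properties using (allFin⁺)
open import Data.List.Membership.Propositional using (_∈_)
open import Data.List.Membership.Propositional.Properties using (∈-lookup; ∈-allFin)
open import Data.List.Relation.Binary.Subset.Propositional using (_⊆_)
open import Data.List.Relation.Binary.Subset.Propositional.Properties using (⊆-refl; ⊆-trans; xs⊆x∷xs; ∷⁺ʳ)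
open import Data.List.Properties using (length-tabulate)
open import Function.Bundles using (mk⇔)
open import Relation.Binary.PropositionalEquality using (_≡_; refl; sym; trans; cong; subst)
open import Relation.Nullary using (yes; no)
open import Data.Empty using (⊥-elim)

Unique⇒lookup-injective : ∀ {a} {A : Set a} {xs : List A} → Unique xs →
  ∀ i j → lookup xs i ≡ lookup xs j → i ≡ j
Unique⇒lookup-injective (_ ∷ _) Fin.zero Fin.zero _ = refl
Unique⇒lookup-injective (x∉ ∷ _) Fin.zero (Fin.suc j) eq = ⊥-elim (All.lookup x∉ (∈-lookup j) eq)
Unique⇒lookup-injective (x∉ ∷ _) (Fin.suc i) Fin.zero eq = ⊥-elim (All.lookup x∉ (∈-lookup i) (sym eq))
Unique⇒lookup-injective (_ ∷ u) (Fin.suc i) (Fin.suc j) eq = cong Fin.suc (Unique⇒lookup-injective u i j eq)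

Unique⇒length≤ : ∀ {n} {xs : List (Fin n)} → Unique xs → length xs ≤ n
Unique⇒length≤ u = injective⇒≤ (Unique⇒lookup-injective u _ _)

module Walks {n : ℕ} (G : Graph n) (O : LinOrder n) where
  open Graph G renaming (sym to E-sym)
  open LinOrder O
  open import Data.List.Membership.DecPropositional (_≟_ {n}) using (_∈?_)

  private
    W = Walk G O

  infixr 5 _++ʷ_
  infixl 5 _∷ʳ_

  _∷ʳ_ : ∀ {a b c ℓ} → W a b ℓ → E b c → W a c (suc ℓ)
  []      ∷ʳ e = e ∷ []
  (d ∷ w) ∷ʳ e = d ∷ (w ∷ʳ e)

  verts-∷ʳ : ∀ {a b c ℓ} (w : W a b ℓ) (e : E b c) → verts G O (w ∷ʳ e) ≡ verts G O w List.∷ʳ c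
  verts-∷ʳ []      e = refl
  verts-∷ʳ (d ∷ w) e = cong (_ ∷_) (verts-∷ʳ w e)

  _++ʷ_ : ∀ {a b c ℓ₁ ℓ₂} → W a b ℓ₁ → W b c ℓ₂ → W a c (ℓ₁ + ℓ₂)
  []      ++ʷ v = v
  (e ∷ w) ++ʷ v = e ∷ (w ++ʷ v)

  All-verts-++ʷ : ∀ {p} {P : Fin n → Set p} {a b c ℓ₁ ℓ₂} (w : W a b ℓ₁) (v : W b c ℓ₂) →
    All P (verts G O w) → All P (verts G O v) → All P (verts G O (w ++ʷ v))
  All-verts-++ʷ []      v _         pv = pv
  All-verts-++ʷ (e ∷ w) v (pa ∷ pw) pv = pa ∷ All-verts-++ʷ w v pw pv

  reverse : ∀ {a b ℓ} → W a b ℓ → W b a ℓ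
  reverse []      = []
  reverse (e ∷ w) = reverse w ∷ʳ E-sym e

  All-verts-reverse : ∀ {p} {P : Fin n → Set p} {a b ℓ} (w : W a b ℓ) →
    All P (verts G O w) → All P (verts G O (reverse w))
  All-verts-reverse []      pw        = pw
  All-verts-reverse (e ∷ w) (pa ∷ pw) =
    subst (All _) (sym (verts-∷ʳ (reverse w) (E-sym e))) (++⁺ (All-verts-reverse w pw) (pa ∷ []))

  end∈verts : ∀ {a b ℓ} (w : W a b ℓ) → b ∈ verts G O w
  end∈verts []      = here refl
  end∈verts (e ∷ w) = there (end∈verts w)

  suffix : ∀ {x b c ℓ} (w : W b c ℓ) → x ∈ verts G O w →
    Σ ℕ λ m → m ≤ ℓ × Σ (W x c m) λ v → (IsPath G O w → IsPath G O v) × verts G O v ⊆ verts G O w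
  suffix []      (here refl) = _ , ≤-refl , [] , (λ p → p) , ⊆-refl
  suffix (e ∷ w) (here refl) = _ , ≤-refl , e ∷ w , (λ p → p) , ⊆-refl
  suffix (e ∷ w) (there x∈w) with suffix w x∈w
  ... | m , m≤ℓ , v , path , v⊆w =
    m , m≤n⇒m≤1+n m≤ℓ , v , (λ { (_ ∷ p) → path p }) , ⊆-trans v⊆w (xs⊆x∷xs _ _)

  -- If a already lies on the path built from the tail, the closed walk through a is cut out.
  walk⇒path : ∀ {a c ℓ} (w : W a c ℓ) →
    Σ ℕ λ m → m ≤ ℓ × Σ (W a c m) λ p → IsPath G O p × verts G O p ⊆ verts G O w
  walk⇒path [] = 0 , z≤n , [] , ([] ∷ []) , ⊆-refl
  walk⇒path {a} (e ∷ w) with walk⇒path w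
  ... | m , m≤ℓ , p , p-path , p⊆w with a ∈? verts G O p
  ... | yes a∈p =
    let (m′ , m′≤m , q , q-path , q⊆p) = suffix p a∈p
    in m′ , m≤n⇒m≤1+n (≤-trans m′≤m m≤ℓ) , q , q-path p-path , ⊆-trans q⊆p (⊆-trans p⊆w (xs⊆x∷xs _ _))
  ... | no a∉p = suc m , s≤s m≤ℓ , e ∷ p , (¬Any⇒All¬ _ a∉p ∷ p-path) , ∷⁺ʳ a p⊆w

  Decreasing : List (Fin n) → Set
  Decreasing = AllPairs (λ x y → rank y < rank x)

  Decreasing⇒IsPath : ∀ {a b ℓ} {w : W a b ℓ} → Decreasing (verts G O w) → IsPath G O w
  Decreasing⇒IsPath = AllPairs.map (λ y<x x≡y → <-irrefl (cong rank (sym x≡y)) y<x)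

  Decreasing⇒end-least : ∀ {a b ℓ} (w : W a b ℓ) → Decreasing (verts G O w) →
    All (λ x → rank b ≤ rank x) (verts G O w)
  Decreasing⇒end-least []      _           = ≤-refl ∷ []
  Decreasing⇒end-least (e ∷ w) (a≻ ∷ dec) = <⇒≤ (All.lookup a≻ (end∈verts w)) ∷ Decreasing⇒end-least w dec

  Decreasing⇒inner-above-end : ∀ {a b ℓ} (w : W a b ℓ) → Decreasing (verts G O w) →
    All (λ x → rank b < rank x) (inner G O w)
  Decreasing⇒inner-above-end []           _                = []
  Decreasing⇒inner-above-end (e ∷ [])     _                = []
  Decreasing⇒inner-above-end (e ∷ d ∷ w) (_ ∷ dec@(b≻ ∷ _)) =
    All.lookup b≻ (end∈verts w) ∷ Decreasing⇒inner-above-end (d ∷ w) dec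

module DecreasingTree {n k : ℕ} {G : Graph n} {O : LinOrder n} (T : DecSpanningTree G O k) where
  open Graph G renaming (sym to E-sym)
  open DecSpanningTree T
  open Walks G O

  iter-suc : ∀ j u → iter G O parent (suc j) u ≡ iter G O parent j (parent u)
  iter-suc zero    u = refl
  iter-suc (suc j) u = cong parent (iter-suc j u)

  treeWalk : ∀ j u → iter G O parent j u ≡ root →
    Σ ℕ λ ℓ → ℓ ≤ j × Σ (Walk G O root u ℓ) λ w → Decreasing (verts G O w)
  treeWalk zero    u refl = 0 , z≤n , [] , [] ∷ []
  treeWalk (suc j) u reaches with u ≟ root
  ... | yes refl = 0 , z≤n , [] , [] ∷ []
  ... | no u≢root with treeWalk j (parent u) (trans (sym (iter-suc j u)) reaches)
  ... | ℓ , ℓ≤j , w , dec =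
    suc ℓ , s≤s ℓ≤j , w ∷ʳ E-sym (edge u u≢root) ,
    subst Decreasing (sym (verts-∷ʳ w _))
      (AllPairs.++⁺ dec ([] ∷ [])
        (All.map (λ p≤x → <-≤-trans (decr u u≢root) p≤x ∷ []) (Decreasing⇒end-least w dec)))

  rootWalk : ∀ u → Σ ℕ λ ℓ → ℓ ≤ k × Σ (Walk G O root u ℓ) λ w → Decreasing (verts G O w)
  rootWalk u with depth u
  ... | j , j≤k , reaches with treeWalk j u reaches
  ... | ℓ , ℓ≤j , w , dec = ℓ , ≤-trans ℓ≤j j≤k , w , dec

  root-wreaches : ∀ u → WReach G O k root u
  root-wreaches u with rootWalk u
  ... | ℓ , ℓ≤k , w , dec = root-max u , ℓ , ℓ≤k , w , Decreasing⇒IsPath dec , Decreasing⇒inner-above-end w dec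

  wcol≡n : WcolIs G O k n
  wcol≡n = (root , allFin n , allFin⁺ n , length-tabulate (λ x → x) , λ u → mk⇔ (λ _ → root-wreaches u) (λ _ → ∈-allFin u))
         , λ { v m (xs , unique , refl , _) → Unique⇒length≤ unique }

  upSet-conn-diam : ∀ v → UpSetConnDiam G O v (2 * k)
  upSet-conn-diam v a b v⪯a v⪯b with rootWalk a | rootWalk b
  ... | ℓ₁ , ℓ₁≤k , w₁ , dec₁ | ℓ₂ , ℓ₂≤k , w₂ , dec₂ with walk⇒path (reverse w₁ ++ʷ w₂)
  ... | m , m≤ℓ , p , p-path , p⊆w =
    m , ≤-trans m≤ℓ ℓ₁+ℓ₂≤2k , p , p-path ,
    anti-mono p⊆w (All-verts-++ʷ (reverse w₁) w₂
      (All-verts-reverse w₁ (All.map (≤-trans v⪯a) (Decreasing⇒end-least w₁ dec₁)))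
      (All.map (≤-trans v⪯b) (Decreasing⇒end-least w₂ dec₂)))
    where
    ℓ₁+ℓ₂≤2k : ℓ₁ + ℓ₂ ≤ 2 * k
    ℓ₁+ℓ₂≤2k = ≤-trans (+-mono-≤ ℓ₁≤k ℓ₂≤k) (≤-reflexive (cong (k +_) (sym (+-identityʳ k))))

lemma11 : (n k : ℕ) (G : Graph n) (O : LinOrder n) →
    DecSpanningTree G O k →
    WcolIs G O k n × (∀ (v : Fin n) → UpSetConnDiam G O v (2 * k))
lemma11 n k G O T = wcol≡n , upSet-conn-diam
  where open DecreasingTree T
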